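{- Let $n,k,\lambda$ be positive integers. If there exists an $(n,k,\lambda)$-SBIBD and $n \ge 2\lambda$, then there exists a $k$-diregular two-way $(2,\lambda)$-liking digraph of order $n$.
   Context: All digraphs are finite, with no loops and no multiple arcs. For positive integers $t$ and $\lambda$, a digraph is a two-way $(t,\lambda)$-liking digraph if every set of $t$ distinct vertices has exactly $\lambda$ common out-neighbors and exactly $\lambda$ common in-neighbors. A digraph is $k$-diregular if every vertex has outdegree $k$ and indegree $k$. A balanced block design consists of a set $X$ of $v\ge 2$ elements (varieties) and a collection of $b>0$ subsets of $X$ (blocks) such that each block has exactly $k>0$ varieties, each variety lies in exactly $r>0$ blocks, and each pair of distinct varieties lies together in exactly $\lambda>0$ blocks; it is incomplete if $k<v$, and is then called a $(b,v,r,k,\lambda)$-BIBD. It is symmetric if $b=v$ and $r=k$; a symmetric $(v,v,k,k,\lambda)$-BIBD is called a $(v,k,\lambda)$-SBIBD. -}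

module Defs where

open import Data.Nat using (ℕ; zero; suc; _+_; _<_; _≤_; _*_)
open import Data.Bool using (Bool; true; false; _∧_)
open import Data.Fin using (Fin; zero; suc)
open import Data.Product using (Σ; _×_; _,_)
open import Relation.Binary.PropositionalEquality using (_≡_; _≢_)

count : ∀ {m} → (Fin m → Bool) → ℕ
count {zero}  p = 0
count {suc m} p = (if0 (p zero)) + count (λ i → p (suc i))
  where
  if0 : Bool → ℕ
  if0 true  = 1
  if0 false = 0

record Digraph (n : ℕ) : Set where
  field
    adj    : Fin n → Fin n → Bool
    noLoop : ∀ x → adj x x ≡ false
open Digraph public

outdeg : ∀ {n} → Digraph n → Fin n → ℕ
outdeg D x = count (λ z → adj D x z)

indeg : ∀ {n} → Digraph n → Fin n → ℕ
indeg D x = count (λ z → adj D z x)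

Diregular : ∀ {n} → ℕ → Digraph n → Set
Diregular k D = ∀ x → outdeg D x ≡ k × indeg D x ≡ k

TwoWayTwoLiking : ∀ {n} → ℕ → Digraph n → Set
TwoWayTwoLiking λ' D =
  ∀ x y → x ≢ y →
    count (λ z → adj D x z ∧ adj D y z) ≡ λ'
    × count (λ z → adj D z x ∧ adj D z y) ≡ λ'

-- Balanced block designs: varieties Fin v, blocks indexed by Fin b
-- (a collection, so repeated blocks are allowed), incidence
-- inc x B = true iff variety x lies in block B.

record IsBIBD (b v r k λ' : ℕ) (inc : Fin v → Fin b → Bool) : Set where
  field
    v≥2       : 2 ≤ v
    b>0       : 0 < b
    k>0       : 0 < k
    r>0       : 0 < r
    λ>0       : 0 < λ'
    incomplete : k < v
    blockSize : ∀ B → count (λ x → inc x B) ≡ k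
    replication : ∀ x → count (λ B → inc x B) ≡ r
    pairs     : ∀ x y → x ≢ y → count (λ B → inc x B ∧ inc y B) ≡ λ'

SBIBD : ℕ → ℕ → ℕ → Set
SBIBD v k λ' = Σ (Fin v → Fin v → Bool) (IsBIBD v v k k λ')

{-# OPTIONS --safe #-}
module Submission where

-- Let σ be a bijection from points to blocks with x ∉ σ x, and join x → y
-- whenever y ∈ σ x.  Out-neighbourhoods are then the blocks σ x, so two of
-- them share as many vertices as two blocks share points, while the
-- in-neighbourhood of x is indexed, through σ, by the k blocks containing x,
-- so two vertices have λ common in-neighbours.  The bijection σ is a perfect
-- matching of the non-incidence graph, which is (n − k)-regular and so
-- satisfies Hall's condition.  That two blocks of a symmetric design meet in
-- λ points follows by counting: for a fixed block B, the numbers |B ∩ C| with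
-- C ≠ B have mean λ and mean square λ², hence all equal λ.

open import Defs
open import Data.Bool.Base using (Bool; true; false; T; not; _∧_; _∨_; if_then_else_)
open import Data.Bool.Properties using (T-∧; T-∨; T-≡; T-not-≡; ∧-identityʳ; ∧-zeroʳ; ∧-idem)
open import Data.Empty using (⊥; ⊥-elim)
open import Data.Fin.Base using (Fin; zero; suc; punchIn; punchOut)
open import Data.Fin.Permutation using (Permutation; permutation)
open import Data.Fin.Properties using (_≟_; any?; punchInᵢ≢i; punchIn-punchOut; punchOut-injective; <⇒notInjective)
open import Data.Fin.Subset.Properties using (anySubset?)
open import Data.Nat.Base using (ℕ; zero; suc; _+_; _*_; _∸_; _≤_; _<_; ∣_-_∣; z≤n; s≤s; s≤s⁻¹; NonZero; >-nonZero)
open import Data.Nat.Induction using (<-wellFounded)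
open import Data.Nat.Properties hiding (_≟_)
open import Data.Nat.Tactic.RingSolver using (solve-∀)
open import Data.Product using (Σ; ∃; ∃₂; _×_; _,_; proj₁; proj₂; uncurry)
open import Data.Sum using (_⊎_; inj₁; inj₂; swap; reduce)
open import Data.Vec.Base using (lookup; tabulate)
open import Data.Vec.Properties using (lookup∘tabulate)
open import Function.Base using (_∘_)
open import Function.Bundles using (Equivalence; mk⇔)
open import Function.Definitions using (Injective)
open import Induction.WellFounded using (Acc; acc)
open import Relation.Binary.PropositionalEquality using (_≡_; _≢_; refl; sym; trans; cong; cong₂; subst; subst₂; module ≡-Reasoning)
open import Relation.Nullary.Decidable using (Dec; yes; no; does; T?; ¬?; dec-true; dec-false; does-⇔; decidable-stable)
open import Relation.Nullary.Negation using (¬_; contradiction)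

open import Algebra.Properties.Semiring.Sum +-*-semiring
  using (sum; sum-syntax; sum-cong-≗; ∑-distrib-+; ∑-comm; *-distribˡ-sum; *-distribʳ-sum; sum-remove; ∑-permute)

private variable
  m n : ℕ

∑-const : ∀ n c → ∑[ i < n ] c ≡ n * c
∑-const zero    c = refl
∑-const (suc n) c = cong (c +_) (∑-const n c)

∑-mono-≤ : {f g : Fin n → ℕ} → (∀ i → f i ≤ g i) → sum f ≤ sum g
∑-mono-≤ {zero}  f≤g = z≤n
∑-mono-≤ {suc n} f≤g = +-mono-≤ (f≤g zero) (∑-mono-≤ (f≤g ∘ suc))

∑-mono-< : {f g : Fin n → ℕ} → (∀ i → f i ≤ g i) → ∀ i → f i < g i → sum f < sum g
∑-mono-< f≤g zero    f₀<g₀ = +-mono-<-≤ f₀<g₀ (∑-mono-≤ (f≤g ∘ suc))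
∑-mono-< f≤g (suc i) fᵢ<gᵢ = +-mono-≤-< (f≤g zero) (∑-mono-< (f≤g ∘ suc) i fᵢ<gᵢ)

+-mono-≤-equality : ∀ {a b c d} → a ≤ c → b ≤ d → a + b ≡ c + d → a ≡ c × b ≡ d
+-mono-≤-equality {a} {b} {c} {d} a≤c b≤d a+b≡c+d = a≡c , +-cancelˡ-≡ a b d (trans a+b≡c+d (cong (_+ d) (sym a≡c)))
  where
  a≡c : a ≡ c
  a≡c = ≤-antisym a≤c (+-cancelʳ-≤ d c a (subst (_≤ a + d) a+b≡c+d (+-monoʳ-≤ a b≤d)))

≤-pointwise∧∑≡⇒≗ : {f g : Fin n → ℕ} → (∀ i → f i ≤ g i) → sum f ≡ sum g → ∀ i → f i ≡ g i
≤-pointwise∧∑≡⇒≗ {suc n} f≤g ∑f≡∑g i with +-mono-≤-equality (f≤g zero) (∑-mono-≤ (f≤g ∘ suc)) ∑f≡∑g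
≤-pointwise∧∑≡⇒≗ {suc n} f≤g ∑f≡∑g zero    | f₀≡g₀ , _    = f₀≡g₀
≤-pointwise∧∑≡⇒≗ {suc n} f≤g ∑f≡∑g (suc i) | _     , tail≡ = ≤-pointwise∧∑≡⇒≗ (f≤g ∘ suc) tail≡ i

∑-square : (w : Fin m → ℕ) (a : Fin m → Fin n → ℕ) →
  ∑[ j < n ] (∑[ i < m ] (w i * a i j) * ∑[ i < m ] (w i * a i j)) ≡
  ∑[ i < m ] (w i * ∑[ i′ < m ] (w i′ * ∑[ j < n ] (a i j * a i′ j)))
∑-square {m} {n} w a = begin
  ∑[ j < n ] (∑[ i < m ] (w i * a i j) * ∑[ i < m ] (w i * a i j))
    ≡⟨ sum-cong-≗ (λ j → *-distribʳ-sum _ (λ i → w i * a i j)) ⟩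
  ∑[ j < n ] ∑[ i < m ] (w i * a i j * ∑[ i′ < m ] (w i′ * a i′ j))
    ≡⟨ sum-cong-≗ (λ j → sum-cong-≗ (λ i → *-distribˡ-sum (w i * a i j) (λ i′ → w i′ * a i′ j))) ⟩
  ∑[ j < n ] ∑[ i < m ] ∑[ i′ < m ] (w i * a i j * (w i′ * a i′ j))
    ≡⟨ ∑-comm (λ j i → ∑[ i′ < m ] (w i * a i j * (w i′ * a i′ j))) ⟩
  ∑[ i < m ] ∑[ j < n ] ∑[ i′ < m ] (w i * a i j * (w i′ * a i′ j))
    ≡⟨ sum-cong-≗ (λ i → ∑-comm (λ j i′ → w i * a i j * (w i′ * a i′ j))) ⟩
  ∑[ i < m ] ∑[ i′ < m ] ∑[ j < n ] (w i * a i j * (w i′ * a i′ j))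
    ≡⟨ sum-cong-≗ (λ i → sum-cong-≗ (λ i′ → sum-cong-≗ (λ j → rearrange (w i) (a i j) (w i′) (a i′ j)))) ⟩
  ∑[ i < m ] ∑[ i′ < m ] ∑[ j < n ] (w i * (w i′ * (a i j * a i′ j)))
    ≡⟨ sum-cong-≗ (λ i → sum-cong-≗ (λ i′ → trans (cong (w i *_) (*-distribˡ-sum (w i′) (λ j → a i j * a i′ j))) (*-distribˡ-sum (w i) (λ j → w i′ * (a i j * a i′ j))))) ⟨
  ∑[ i < m ] ∑[ i′ < m ] (w i * (w i′ * ∑[ j < n ] (a i j * a i′ j)))
    ≡⟨ sum-cong-≗ (λ i → *-distribˡ-sum (w i) (λ i′ → w i′ * ∑[ j < n ] (a i j * a i′ j))) ⟨
  ∑[ i < m ] (w i * ∑[ i′ < m ] (w i′ * ∑[ j < n ] (a i j * a i′ j)))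
    ∎
  where
  open ≡-Reasoning
  rearrange : ∀ w a w′ a′ → w * a * (w′ * a′) ≡ w * (w′ * (a * a′))
  rearrange = solve-∀

sum-of-squares : ∀ a b → a * a + b * b ≡ 2 * a * b + ∣ a - b ∣ * ∣ a - b ∣
sum-of-squares a b with ≤-total a b
... | inj₁ a≤b with d , refl ← m≤n⇒∃[o]m+o≡n a≤b
  rewrite ∣m-m+n∣≡n a d = identity a d
  where
  identity : ∀ a d → a * a + (a + d) * (a + d) ≡ 2 * a * (a + d) + d * d
  identity = solve-∀
... | inj₂ b≤a with d , refl ← m≤n⇒∃[o]m+o≡n b≤a
  rewrite ∣-∣-comm (b + d) b | ∣m-m+n∣≡n b d = identity b d
  where
  identity : ∀ b d → (b + d) * (b + d) + b * b ≡ 2 * (b + d) * b + d * d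
  identity = solve-∀

2ab≤a²+b² : ∀ a b → 2 * a * b ≤ a * a + b * b
2ab≤a²+b² a b = subst (2 * a * b ≤_) (sym (sum-of-squares a b)) (m≤m+n _ _)

2ab≡a²+b²⇒a≡b : ∀ a b → 2 * a * b ≡ a * a + b * b → a ≡ b
2ab≡a²+b²⇒a≡b a b eq = ∣m-n∣≡0⇒m≡n (reduce (m*n≡0⇒m≡0∨n≡0 ∣ a - b ∣ (+-cancelˡ-≡ (2 * a * b) _ 0 (begin
  2 * a * b + ∣ a - b ∣ * ∣ a - b ∣ ≡⟨ sum-of-squares a b ⟨
  a * a + b * b                     ≡⟨ eq ⟨
  2 * a * b                         ≡⟨ +-identityʳ _ ⟨
  2 * a * b + 0                     ∎))))
  where open ≡-Reasoning

-- This is ∑ (f i − a)² = 0 without subtraction: termwise 2·a·f i ≤ a² + f i², with equal sums.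
moments⇒constant : (f : Fin n → ℕ) (a : ℕ) →
  ∑[ i < n ] f i ≡ n * a → ∑[ i < n ] (f i * f i) ≡ n * (a * a) → ∀ i → f i ≡ a
moments⇒constant {n} f a ∑f ∑f² i =
  sym (2ab≡a²+b²⇒a≡b a (f i) (≤-pointwise∧∑≡⇒≗ (λ i → 2ab≤a²+b² a (f i)) ∑-equal i))
  where
  open ≡-Reasoning
  ∑-equal : ∑[ i < n ] (2 * a * f i) ≡ ∑[ i < n ] (a * a + f i * f i)
  ∑-equal = begin
    ∑[ i < n ] (2 * a * f i)                         ≡⟨ *-distribˡ-sum (2 * a) f ⟨
    2 * a * ∑[ i < n ] f i                           ≡⟨ cong (2 * a *_) ∑f ⟩
    2 * a * (n * a)                                  ≡⟨ double n a ⟩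
    n * (a * a) + n * (a * a)                        ≡⟨ cong₂ _+_ (∑-const n (a * a)) ∑f² ⟨
    ∑[ i < n ] (a * a) + ∑[ i < n ] (f i * f i)      ≡⟨ ∑-distrib-+ (λ _ → a * a) (λ i → f i * f i) ⟨
    ∑[ i < n ] (a * a + f i * f i)                   ∎
    where
    double : ∀ n a → 2 * a * (n * a) ≡ n * (a * a) + n * (a * a)
    double = solve-∀

𝟙 : Bool → ℕ
𝟙 true  = 1
𝟙 false = 0

𝟙-mono : ∀ {a b} → (T a → T b) → 𝟙 a ≤ 𝟙 b
𝟙-mono {false}         _   = z≤n
𝟙-mono {true}  {true}  _   = ≤-refl
𝟙-mono {true}  {false} a⇒b = ⊥-elim (a⇒b _)

𝟙-≡0 : ∀ {a} → ¬ T a → 𝟙 a ≡ 0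
𝟙-≡0 {false} _  = refl
𝟙-≡0 {true}  ¬a = ⊥-elim (¬a _)

𝟙-≡1 : ∀ {a} → T a → 𝟙 a ≡ 1
𝟙-≡1 {true} _ = refl

𝟙-∧ : ∀ a b → 𝟙 (a ∧ b) ≡ 𝟙 a * 𝟙 b
𝟙-∧ true  b = sym (+-identityʳ (𝟙 b))
𝟙-∧ false b = refl

𝟙-∨+𝟙-∧ : ∀ a b → 𝟙 (a ∨ b) + 𝟙 (a ∧ b) ≡ 𝟙 a + 𝟙 b
𝟙-∨+𝟙-∧ true  true  = refl
𝟙-∨+𝟙-∧ true  false = refl
𝟙-∨+𝟙-∧ false b     = +-identityʳ (𝟙 b)

𝟙-not+𝟙 : ∀ a → 𝟙 (not a) + 𝟙 a ≡ 1
𝟙-not+𝟙 true  = refl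
𝟙-not+𝟙 false = refl

count-as-∑ : (p : Fin n → Bool) → count p ≡ ∑[ i < n ] 𝟙 (p i)
count-as-∑ {zero}  p = refl
count-as-∑ {suc n} p with p zero
... | true  = cong suc (count-as-∑ (p ∘ suc))
... | false = count-as-∑ (p ∘ suc)

module _ {p q : Fin n → Bool} where

  count-cong : (∀ i → p i ≡ q i) → count p ≡ count q
  count-cong p≗q = begin
    count p               ≡⟨ count-as-∑ p ⟩
    ∑[ i < n ] 𝟙 (p i)    ≡⟨ sum-cong-≗ (cong 𝟙 ∘ p≗q) ⟩
    ∑[ i < n ] 𝟙 (q i)    ≡⟨ count-as-∑ q ⟨
    count q               ∎
    where open ≡-Reasoning

  count-mono : (∀ i → T (p i) → T (q i)) → count p ≤ count q
  count-mono p⊆q = subst₂ _≤_ (sym (count-as-∑ p)) (sym (count-as-∑ q)) (∑-mono-≤ (𝟙-mono ∘ p⊆q))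

count-∨+count-∧ : (p q : Fin n → Bool) →
  count (λ i → p i ∨ q i) + count (λ i → p i ∧ q i) ≡ count p + count q
count-∨+count-∧ {n} p q = begin
  count (λ i → p i ∨ q i) + count (λ i → p i ∧ q i)       ≡⟨ cong₂ _+_ (count-as-∑ (λ i → p i ∨ q i)) (count-as-∑ (λ i → p i ∧ q i)) ⟩
  ∑[ i < n ] 𝟙 (p i ∨ q i) + ∑[ i < n ] 𝟙 (p i ∧ q i)     ≡⟨ ∑-distrib-+ (λ i → 𝟙 (p i ∨ q i)) _ ⟨
  ∑[ i < n ] (𝟙 (p i ∨ q i) + 𝟙 (p i ∧ q i))              ≡⟨ sum-cong-≗ (λ i → 𝟙-∨+𝟙-∧ (p i) (q i)) ⟩
  ∑[ i < n ] (𝟙 (p i) + 𝟙 (q i))                          ≡⟨ ∑-distrib-+ (𝟙 ∘ p) (𝟙 ∘ q) ⟩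
  ∑[ i < n ] 𝟙 (p i) + ∑[ i < n ] 𝟙 (q i)                 ≡⟨ cong₂ _+_ (count-as-∑ p) (count-as-∑ q) ⟨
  count p + count q                                       ∎
  where open ≡-Reasoning

module _ (p : Fin n → Bool) where

  count-≡0 : (∀ i → ¬ T (p i)) → count p ≡ 0
  count-≡0 ¬p = begin
    count p              ≡⟨ count-as-∑ p ⟩
    ∑[ i < n ] 𝟙 (p i)   ≡⟨ sum-cong-≗ (𝟙-≡0 ∘ ¬p) ⟩
    ∑[ i < n ] 0         ≡⟨ ∑-const n 0 ⟩
    n * 0                ≡⟨ *-zeroʳ n ⟩
    0                    ∎
    where open ≡-Reasoning

  count-not : count (not ∘ p) ≡ n ∸ count p
  count-not = begin
    count (not ∘ p)                                       ≡⟨ m+n∸n≡m (count (not ∘ p)) (count p) ⟨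
    (count (not ∘ p) + count p) ∸ count p                 ≡⟨ cong (λ c → (c + count p) ∸ count p) (count-as-∑ (not ∘ p)) ⟩
    (∑[ i < n ] 𝟙 (not (p i)) + count p) ∸ count p       ≡⟨ cong (λ c → (∑[ i < n ] 𝟙 (not (p i)) + c) ∸ count p) (count-as-∑ p) ⟩
    (∑[ i < n ] 𝟙 (not (p i)) + ∑[ i < n ] 𝟙 (p i)) ∸ count p ≡⟨ cong (_∸ count p) (∑-distrib-+ (𝟙 ∘ not ∘ p) (𝟙 ∘ p)) ⟨
    ∑[ i < n ] (𝟙 (not (p i)) + 𝟙 (p i)) ∸ count p       ≡⟨ cong (_∸ count p) (sum-cong-≗ (𝟙-not+𝟙 ∘ p)) ⟩
    ∑[ i < n ] 1 ∸ count p                                ≡⟨ cong (_∸ count p) (trans (∑-const n 1) (*-identityʳ n)) ⟩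
    n ∸ count p                                           ∎
    where open ≡-Reasoning

  count-∧ˡ : ∀ b → count (λ i → b ∧ p i) ≡ 𝟙 b * count p
  count-∧ˡ b = begin
    count (λ i → b ∧ p i)          ≡⟨ count-as-∑ (λ i → b ∧ p i) ⟩
    ∑[ i < n ] 𝟙 (b ∧ p i)         ≡⟨ sum-cong-≗ (𝟙-∧ b ∘ p) ⟩
    ∑[ i < n ] (𝟙 b * 𝟙 (p i))     ≡⟨ *-distribˡ-sum (𝟙 b) (𝟙 ∘ p) ⟨
    𝟙 b * ∑[ i < n ] 𝟙 (p i)       ≡⟨ cong (𝟙 b *_) (count-as-∑ p) ⟨
    𝟙 b * count p                  ∎
    where open ≡-Reasoning

  0<count⇒∃ : 0 < count p → ∃ λ i → T (p i)
  0<count⇒∃ 0<count with any? (T? ∘ p)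
  ... | yes ∃p = ∃p
  ... | no  ∄p = contradiction (count-≡0 (λ i pᵢ → ∄p (i , pᵢ))) (>⇒≢ 0<count)

count-removeAt : ∀ (p : Fin (suc n) → Bool) i → count p ≡ 𝟙 (p i) + count (p ∘ punchIn i)
count-removeAt p i = begin
  count p                                   ≡⟨ count-as-∑ p ⟩
  sum (𝟙 ∘ p)                               ≡⟨ sum-remove {i = i} (𝟙 ∘ p) ⟩
  𝟙 (p i) + sum (𝟙 ∘ p ∘ punchIn i)         ≡⟨ cong (𝟙 (p i) +_) (count-as-∑ (p ∘ punchIn i)) ⟨
  𝟙 (p i) + count (p ∘ punchIn i)           ∎
  where open ≡-Reasoning

∃⇒0<count : (p : Fin n → Bool) (i : Fin n) → T (p i) → 0 < count p
∃⇒0<count {suc n} p i pᵢ = subst (0 <_) (sym (count-removeAt p i))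
  (subst (λ c → 0 < c + count (p ∘ punchIn i)) (sym (𝟙-≡1 pᵢ)) (s≤s z≤n))

infixl 6 _∖_

_∖_ : (Fin n → Bool) → Fin n → Fin n → Bool
(p ∖ i) j = p j ∧ not (does (j ≟ i))

module _ {p : Fin n → Bool} {i : Fin n} where

  ∖-≢ : ∀ {j} → j ≢ i → (p ∖ i) j ≡ p j
  ∖-≢ {j} j≢i = trans (cong (λ b → p j ∧ not b) (dec-false (j ≟ i) j≢i)) (∧-identityʳ (p j))

  ∖-self : (p ∖ i) i ≡ false
  ∖-self = trans (cong (λ b → p i ∧ not b) (dec-true (i ≟ i) refl)) (∧-zeroʳ (p i))

  ∖⁺ : ∀ {j} → T (p j) → j ≢ i → T ((p ∖ i) j)
  ∖⁺ pⱼ j≢i = subst T (sym (∖-≢ j≢i)) pⱼ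

  ∖⁻ : ∀ {j} → T ((p ∖ i) j) → T (p j) × j ≢ i
  ∖⁻ {j} t = proj₁ (Equivalence.to T-∧ t) , λ { refl → subst T ∖-self t }

count-∖ : ∀ (p : Fin n → Bool) {i} → T (p i) → count p ≡ suc (count (p ∖ i))
count-∖ {suc n} p {i} pᵢ = begin
  count p                                   ≡⟨ count-removeAt p i ⟩
  𝟙 (p i) + count (p ∘ punchIn i)           ≡⟨ cong (_+ count (p ∘ punchIn i)) (𝟙-≡1 pᵢ) ⟩
  suc (count (p ∘ punchIn i))               ≡⟨ cong suc (count-cong (∖-≢ {p = p} ∘ punchInᵢ≢i i)) ⟨
  suc (count ((p ∖ i) ∘ punchIn i))         ≡⟨ cong (λ b → suc (𝟙 b + count ((p ∖ i) ∘ punchIn i))) (∖-self {p = p}) ⟨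
  suc (𝟙 ((p ∖ i) i) + count ((p ∖ i) ∘ punchIn i)) ≡⟨ cong suc (count-removeAt (p ∖ i) i) ⟨
  suc (count (p ∖ i))                       ∎
  where open ≡-Reasoning

module _ (p : Fin n → Bool) where

  2≤count⇒distinct : 2 ≤ count p → ∃₂ λ i j → i ≢ j × T (p i) × T (p j)
  2≤count⇒distinct 2≤count with i , pᵢ ← 0<count⇒∃ p (≤-trans (s≤s z≤n) 2≤count)
    with j , [p∖i]ⱼ ← 0<count⇒∃ (p ∖ i) (s≤s⁻¹ (subst (2 ≤_) (count-∖ p pᵢ) 2≤count))
    with pⱼ , j≢i ← ∖⁻ {p = p} [p∖i]ⱼ = i , j , j≢i ∘ sym , pᵢ , pⱼ

  distinct⇒2≤count : ∀ {i j} → i ≢ j → T (p i) → T (p j) → 2 ≤ count p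
  distinct⇒2≤count {i} {j} i≢j pᵢ pⱼ = subst (2 ≤_) (sym (count-∖ p pᵢ))
    (s≤s (∃⇒0<count (p ∖ i) j (∖⁺ {p = p} pⱼ (i≢j ∘ sym))))

  count≤1⇒unique : count p ≤ 1 → ∀ {i j} → T (p i) → T (p j) → i ≡ j
  count≤1⇒unique count≤1 {i} {j} pᵢ pⱼ with i ≟ j
  ... | yes i≡j = i≡j
  ... | no  i≢j = contradiction (distinct⇒2≤count i≢j pᵢ pⱼ) (<⇒≱ (s≤s count≤1))

∑-count-comm : (R : Fin m → Fin n → Bool) → ∑[ i < m ] count (R i) ≡ ∑[ j < n ] count (λ i → R i j)
∑-count-comm {m} {n} R = begin
  ∑[ i < m ] count (R i)                    ≡⟨ sum-cong-≗ (count-as-∑ ∘ R) ⟩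
  ∑[ i < m ] ∑[ j < n ] 𝟙 (R i j)           ≡⟨ ∑-comm (λ i j → 𝟙 (R i j)) ⟩
  ∑[ j < n ] ∑[ i < m ] 𝟙 (R i j)           ≡⟨ sum-cong-≗ (λ j → count-as-∑ (λ i → R i j)) ⟨
  ∑[ j < n ] count (λ i → R i j)            ∎
  where open ≡-Reasoning

∑-𝟙*-const : (p : Fin n → Bool) {f : Fin n → ℕ} {c : ℕ} →
  (∀ i → T (p i) → f i ≡ c) → ∑[ i < n ] (𝟙 (p i) * f i) ≡ count p * c
∑-𝟙*-const {n} p {f} {c} f≡c = begin
  ∑[ i < n ] (𝟙 (p i) * f i)     ≡⟨ sum-cong-≗ 𝟙*f≡𝟙*c ⟩
  ∑[ i < n ] (𝟙 (p i) * c)       ≡⟨ *-distribʳ-sum c (𝟙 ∘ p) ⟨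
  ∑[ i < n ] 𝟙 (p i) * c         ≡⟨ cong (_* c) (count-as-∑ p) ⟨
  count p * c                    ∎
  where
  open ≡-Reasoning
  𝟙*f≡𝟙*c : ∀ i → 𝟙 (p i) * f i ≡ 𝟙 (p i) * c
  𝟙*f≡𝟙*c i with p i | f≡c i
  ... | true  | f≡c = cong (_+ 0) (f≡c _)
  ... | false | _   = refl

count-true : ∀ n → count {n} (λ _ → true) ≡ n
count-true zero    = refl
count-true (suc n) = cong suc (count-true n)

count-∧-as-∑ : (p q : Fin n → Bool) → count (λ i → p i ∧ q i) ≡ ∑[ i < n ] (𝟙 (p i) * 𝟙 (q i))
count-∧-as-∑ p q = trans (count-as-∑ (λ i → p i ∧ q i)) (sum-cong-≗ (λ i → 𝟙-∧ (p i) (q i)))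

∑-count-∧ : (R : Fin m → Fin n → Bool) (p : Fin m → Bool) {c : ℕ} → (∀ i → count (R i) ≡ c) →
  ∑[ j < n ] count (λ i → p i ∧ R i j) ≡ count p * c
∑-count-∧ {m} {n} R p {c} rows≡c = begin
  ∑[ j < n ] count (λ i → p i ∧ R i j)     ≡⟨ ∑-count-comm (λ i j → p i ∧ R i j) ⟨
  ∑[ i < m ] count (λ j → p i ∧ R i j)     ≡⟨ sum-cong-≗ (λ i → count-∧ˡ (R i) (p i)) ⟩
  ∑[ i < m ] (𝟙 (p i) * count (R i))       ≡⟨ ∑-𝟙*-const p (λ i _ → rows≡c i) ⟩
  count p * c                              ∎
  where open ≡-Reasoning

injective⇒surjective : {σ : Fin n → Fin n} → Injective _≡_ _≡_ σ → ∀ j → ∃ λ i → σ i ≡ j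
injective⇒surjective {suc n} {σ} σ-inj j with any? (λ i → σ i ≟ j)
... | yes hit  = hit
... | no  miss = contradiction (λ {i} {i′} → τ-inj {i} {i′}) (<⇒notInjective ≤-refl)
  where
  j≢σ : ∀ i → j ≢ σ i
  j≢σ i j≡σi = miss (i , sym j≡σi)
  τ : Fin (suc n) → Fin n
  τ i = punchOut (j≢σ i)
  τ-inj : Injective _≡_ _≡_ τ
  τ-inj {i} {i′} = σ-inj ∘ punchOut-injective (j≢σ i) (j≢σ i′)

count-∘-injective : (p : Fin n → Bool) {σ : Fin n → Fin n} → Injective _≡_ _≡_ σ → count (p ∘ σ) ≡ count p
count-∘-injective {n} p {σ} σ-inj = begin
  count (p ∘ σ)             ≡⟨ count-as-∑ (p ∘ σ) ⟩
  ∑[ i < n ] 𝟙 (p (σ i))    ≡⟨ ∑-permute (𝟙 ∘ p) π ⟨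
  ∑[ i < n ] 𝟙 (p i)        ≡⟨ count-as-∑ p ⟨
  count p                   ∎
  where
  open ≡-Reasoning
  surjective : ∀ j → ∃ λ i → σ i ≡ j
  surjective = injective⇒surjective {σ = σ} σ-inj
  π : Permutation n n
  π = permutation σ (proj₁ ∘ surjective) (proj₂ ∘ surjective) (λ i → σ-inj (proj₂ (surjective (σ i))))

-- Hall's marriage theorem

does-≟⇒≡ : ∀ (i j : Fin n) → T (does (i ≟ j)) → i ≡ j
does-≟⇒≡ i j t with i ≟ j
... | yes i≡j = i≡j

BoolMatrix : ℕ → ℕ → Set
BoolMatrix m n = Fin m → Fin n → Bool

neighbourhood : BoolMatrix m n → (Fin m → Bool) → Fin n → Bool
neighbourhood A S c = does (any? λ x → T? (S x ∧ A x c))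

module _ {A : BoolMatrix m n} {S : Fin m → Bool} where

  neighbourhood⁺ : ∀ {x c} → T (S x) → T (A x c) → T (neighbourhood A S c)
  neighbourhood⁺ {x} {c} x∈S xc∈A = Equivalence.from T-≡ (dec-true (any? _) (x , Equivalence.from T-∧ (x∈S , xc∈A)))

  neighbourhood⁻ : ∀ {c} → T (neighbourhood A S c) → ∃ λ x → T (S x) × T (A x c)
  neighbourhood⁻ {c} t with any? (λ x → T? (S x ∧ A x c))
  ... | yes (x , x∈S∧xc∈A) = x , Equivalence.to T-∧ x∈S∧xc∈A

HallCondition : BoolMatrix m n → Set
HallCondition A = ∀ S → count S ≤ count (neighbourhood A S)

Matching : BoolMatrix m n → Set
Matching {m} {n} A = Σ (Fin m → Fin n) λ σ → (∀ x → T (A x (σ x))) × Injective _≡_ _≡_ σ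

all-subsets? : {P : (Fin m → Bool) → Set} → (∀ {S S′} → (∀ x → S x ≡ S′ x) → P S → P S′) →
  (∀ S → Dec (P S)) → Dec (∀ S → P S)
all-subsets? P-resp P? with anySubset? (λ s → ¬? (P? (lookup s)))
... | yes (s , ¬Pₛ) = no λ ∀P → ¬Pₛ (∀P (lookup s))
... | no  ∄¬P       = yes λ S → P-resp (lookup∘tabulate S)
                              (decidable-stable (P? _) λ ¬P → ∄¬P (tabulate S , ¬P))

neighbourhood-cong : (A : BoolMatrix m n) {S S′ : Fin m → Bool} → (∀ x → S x ≡ S′ x) →
  ∀ c → neighbourhood A S c ≡ neighbourhood A S′ c
neighbourhood-cong A {S} {S′} S≗S′ c =
  does-⇔ (mk⇔ (transport S S′ S≗S′) (transport S′ S (sym ∘ S≗S′))) (any? _) (any? _)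
  where
  transport : ∀ R R′ → (∀ x → R x ≡ R′ x) → ∃ (λ x → T (R x ∧ A x c)) → ∃ (λ x → T (R′ x ∧ A x c))
  transport R R′ R≗R′ (x , t) = x , subst (λ b → T (b ∧ A x c)) (R≗R′ x) t

HallCondition? : (A : BoolMatrix m n) → Dec (HallCondition A)
HallCondition? A = all-subsets? hall-resp (λ S → count S ≤? count (neighbourhood A S))
  where
  hall-resp : ∀ {S S′} → (∀ x → S x ≡ S′ x) → count S ≤ count (neighbourhood A S) → count S′ ≤ count (neighbourhood A S′)
  hall-resp S≗S′ = subst₂ _≤_ (count-cong S≗S′) (count-cong (neighbourhood-cong A S≗S′))

delete : BoolMatrix m n → Fin m → Fin n → BoolMatrix m n
delete A x b y = if does (y ≟ x) then A y ∖ b else A y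

module _ {A : BoolMatrix m n} {x : Fin m} {b : Fin n} where

  delete-⊆ : ∀ y c → T (delete A x b y c) → T (A y c)
  delete-⊆ y c t with y ≟ x
  ... | yes _ = proj₁ (∖⁻ {p = A y} t)
  ... | no  _ = t

  delete-≢row : ∀ {y c} → y ≢ x → T (A y c) → T (delete A x b y c)
  delete-≢row {y} y≢x a with y ≟ x
  ... | yes y≡x = contradiction y≡x y≢x
  ... | no  _   = a

  delete-≢col : ∀ {y c} → c ≢ b → T (A y c) → T (delete A x b y c)
  delete-≢col {y} c≢b a with y ≟ x
  ... | yes _ = ∖⁺ {p = A y} a c≢b
  ... | no  _ = a

  delete-cases : ∀ {y c} → T (A y c) → T (delete A x b y c) ⊎ (y ≡ x × c ≡ b)
  delete-cases {y} {c} a with c ≟ b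
  ... | no  c≢b = inj₁ (delete-≢col c≢b a)
  ... | yes c≡b with y ≟ x
  ...   | yes y≡x = inj₂ (y≡x , c≡b)
  ...   | no  _   = inj₁ a

edges : BoolMatrix m n → ℕ
edges {m} A = ∑[ y < m ] count (A y)

edges-delete : ∀ (A : BoolMatrix m n) {x b} → T (A x b) → edges (delete A x b) < edges A
edges-delete A {x} {b} xb∈A = ∑-mono-< row≤ x row-x<
  where
  row≤ : ∀ y → count (delete A x b y) ≤ count (A y)
  row≤ y = count-mono (delete-⊆ {A = A} y)
  row-x< : count (delete A x b x) < count (A x)
  row-x< with x ≟ x
  ... | yes _   = ≤-reflexive (sym (count-∖ (A x) xb∈A))
  ... | no  x≢x = contradiction refl x≢x

-- Rado's exchange argument: if deleting either of two entries x b₁, x b₂ of A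
-- produced sets S₁, S₂ violating Hall's condition, then x ∈ S₁ ∩ S₂, and
-- Hall's condition for A on S₁ ∪ S₂ and on (S₁ ∩ S₂) ∖ x, together with
-- |N₁ ∪ N₂| + |N₁ ∩ N₂| = |N₁| + |N₂|, gives |S₁| + |S₂| ≤ |N₁| + |N₂| + 1.
module Exchange {A : BoolMatrix m n} (hall : HallCondition A) {x : Fin m} {b₁ b₂ : Fin n} (b₁≢b₂ : b₁ ≢ b₂) where

  private
    A₁ = delete A x b₁
    A₂ = delete A x b₂
    N = neighbourhood A

  hall-off-x : ∀ {b} S → ¬ T (S x) → count S ≤ count (neighbourhood (delete A x b) S)
  hall-off-x {b} S x∉S = ≤-trans (hall S) (count-mono N⊆)
    where
    N⊆ : ∀ c → T (N S c) → T (neighbourhood (delete A x b) S c)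
    N⊆ c t with y , y∈S , yc∈A ← neighbourhood⁻ {A = A} t =
      neighbourhood⁺ {A = delete A x b} y∈S (delete-≢row {A = A} (λ { refl → x∉S y∈S }) yc∈A)

  survives : ∀ {b b′} S S′ → b ≢ b′ → T (S′ x) → ∀ {y c} → T (S y) → T (A y c) →
    T (neighbourhood (delete A x b) S c) ⊎ T (neighbourhood (delete A x b′) S′ c)
  survives S S′ b≢b′ x∈S′ y∈S yc∈A with delete-cases {A = A} yc∈A
  ... | inj₁ kept          = inj₁ (neighbourhood⁺ {A = delete A x _} y∈S kept)
  ... | inj₂ (refl , refl) = inj₂ (neighbourhood⁺ {A = delete A x _} x∈S′ (delete-≢col {A = A} b≢b′ yc∈A))

  no-two-violations : ∀ S₁ S₂ → count (neighbourhood A₁ S₁) < count S₁ → count (neighbourhood A₂ S₂) < count S₂ → ⊥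
  no-two-violations S₁ S₂ viol₁ viol₂ with T? (S₁ x) | T? (S₂ x)
  ... | no x∉S₁ | _        = <⇒≱ viol₁ (hall-off-x S₁ x∉S₁)
  ... | yes _   | no x∉S₂  = <⇒≱ viol₂ (hall-off-x S₂ x∉S₂)
  ... | yes x∈S₁ | yes x∈S₂ = <-irrefl refl (begin-strict
      count S₁ + count S₂                          ≡⟨ count-∨+count-∧ S₁ S₂ ⟨
      count U + count I                            ≡⟨ cong (count U +_) (count-∖ I (Equivalence.from T-∧ (x∈S₁ , x∈S₂))) ⟩
      count U + suc (count (I ∖ x))                ≤⟨ +-mono-≤ (hall U) (s≤s (hall (I ∖ x))) ⟩
      count (N U) + suc (count (N (I ∖ x)))        ≤⟨ +-mono-≤ (count-mono N[U]⊆) (s≤s (count-mono N[I∖x]⊆)) ⟩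
      count N₁∪N₂ + suc (count N₁∩N₂)              ≡⟨ +-suc _ _ ⟩
      suc (count N₁∪N₂ + count N₁∩N₂)              ≡⟨ cong suc (count-∨+count-∧ N₁ N₂) ⟩
      suc (count N₁ + count N₂)                    <⟨ s≤s (+-monoʳ-< (count N₁) (n<1+n (count N₂))) ⟩
      suc (count N₁) + suc (count N₂)              ≤⟨ +-mono-≤ viol₁ viol₂ ⟩
      count S₁ + count S₂                          ∎)
    where
    open ≤-Reasoning
    U I : Fin m → Bool
    U y = S₁ y ∨ S₂ y
    I y = S₁ y ∧ S₂ y
    N₁ N₂ N₁∪N₂ N₁∩N₂ : Fin n → Bool
    N₁ = neighbourhood A₁ S₁
    N₂ = neighbourhood A₂ S₂
    N₁∪N₂ c = N₁ c ∨ N₂ c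
    N₁∩N₂ c = N₁ c ∧ N₂ c
    N[U]⊆ : ∀ c → T (N U c) → T (N₁∪N₂ c)
    N[U]⊆ c t with y , y∈U , yc∈A ← neighbourhood⁻ {A = A} t | Equivalence.to T-∨ y∈U
    ... | inj₁ y∈S₁ = Equivalence.from T-∨ (survives S₁ S₂ b₁≢b₂ x∈S₂ y∈S₁ yc∈A)
    ... | inj₂ y∈S₂ = Equivalence.from T-∨ (swap (survives S₂ S₁ (b₁≢b₂ ∘ sym) x∈S₁ y∈S₂ yc∈A))
    N[I∖x]⊆ : ∀ c → T (N (I ∖ x) c) → T (N₁∩N₂ c)
    N[I∖x]⊆ c t with y , y∈I∖x , yc∈A ← neighbourhood⁻ {A = A} t
      with y∈I , y≢x ← ∖⁻ {p = I} y∈I∖x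
      with y∈S₁ , y∈S₂ ← Equivalence.to T-∧ y∈I =
      Equivalence.from T-∧ ( neighbourhood⁺ {A = A₁} y∈S₁ (delete-≢row {A = A} y≢x yc∈A)
                           , neighbourhood⁺ {A = A₂} y∈S₂ (delete-≢row {A = A} y≢x yc∈A))

  hall-after-deletion : HallCondition A₁ ⊎ HallCondition A₂
  hall-after-deletion with HallCondition? A₁
  ... | yes hall₁ = inj₁ hall₁
  ... | no ¬hall₁ = inj₂ λ S₂ → decidable-stable (_ ≤? _) λ viol₂ → ¬hall₁ λ S₁ →
          decidable-stable (_ ≤? _) λ viol₁ → no-two-violations S₁ S₂ (≰⇒> viol₁) (≰⇒> viol₂)

matching-mono : {A A′ : BoolMatrix m n} → (∀ y c → T (A′ y c) → T (A y c)) → Matching A′ → Matching A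
matching-mono A′⊆A (σ , σ∈A′ , σ-inj) = σ , (λ x → A′⊆A x _ (σ∈A′ x)) , σ-inj

-- Hall's condition on {x} gives row x an entry σ x; on {x, y} with σ x ≡ σ y
-- it would fail, since both rows then have σ x as their only entry.
sparse-matching : (A : BoolMatrix m n) → HallCondition A → (∀ x → count (A x) ≤ 1) → Matching A
sparse-matching {m} {n} A hall sparse = σ , σ∈A , σ-inj
  where
  ⁅_⁆ : Fin m → Fin m → Bool
  ⁅ x ⁆ y = does (y ≟ x)
  x∈⁅x⁆ : ∀ x → T (⁅ x ⁆ x)
  x∈⁅x⁆ x = Equivalence.from T-≡ (dec-true (x ≟ x) refl)
  choice : ∀ x → ∃ λ c → T (A x c)
  choice x with c , c∈N ← 0<count⇒∃ (neighbourhood A ⁅ x ⁆) (≤-trans (∃⇒0<count ⁅ x ⁆ x (x∈⁅x⁆ x)) (hall ⁅ x ⁆))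
           with y , y∈⁅x⁆ , yc∈A ← neighbourhood⁻ {A = A} c∈N = c , subst (λ z → T (A z c)) (does-≟⇒≡ y x y∈⁅x⁆) yc∈A
  σ : Fin m → Fin n
  σ = proj₁ ∘ choice
  σ∈A : ∀ x → T (A x (σ x))
  σ∈A = proj₂ ∘ choice
  σ-inj : Injective _≡_ _≡_ σ
  σ-inj {x} {y} σx≡σy with x ≟ y
  ... | yes x≡y = x≡y
  ... | no  x≢y = contradiction (≤-trans (hall pair) (≤-trans (count-mono N[pair]⊆) (sparse x))) (<⇒≱ 2≤|pair|)
    where
    pair : Fin m → Bool
    pair z = ⁅ x ⁆ z ∨ ⁅ y ⁆ z
    2≤|pair| : 2 ≤ count pair
    2≤|pair| = distinct⇒2≤count pair x≢y (Equivalence.from T-∨ (inj₁ (x∈⁅x⁆ x))) (Equivalence.from T-∨ (inj₂ (x∈⁅x⁆ y)))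
    N[pair]⊆ : ∀ c → T (neighbourhood A pair c) → T (A x c)
    N[pair]⊆ c t with z , z∈pair , zc∈A ← neighbourhood⁻ {A = A} t = subst (T ∘ A x) (sym c≡σx) (σ∈A x)
      where
      c≡σx : c ≡ σ x
      c≡σx with Equivalence.to T-∨ z∈pair
      ... | inj₁ z∈⁅x⁆ with refl ← does-≟⇒≡ z x z∈⁅x⁆ = count≤1⇒unique (A z) (sparse z) zc∈A (σ∈A z)
      ... | inj₂ z∈⁅y⁆ with refl ← does-≟⇒≡ z y z∈⁅y⁆ = trans (count≤1⇒unique (A z) (sparse z) zc∈A (σ∈A z)) (sym σx≡σy)

-- By induction on the number of entries: while some row has two entries, one
-- of them can be deleted without breaking Hall's condition.
hall⇒matching : (A : BoolMatrix m n) → HallCondition A → Matching A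
hall⇒matching A = go A (<-wellFounded (edges A))
  where
  go : ∀ A → Acc _<_ (edges A) → HallCondition A → Matching A
  go A (acc smaller) hall with any? (λ x → 2 ≤? count (A x))
  ... | no  ∄dense = sparse-matching A hall (λ x → ≤-pred (≰⇒> (λ 2≤ → ∄dense (x , 2≤))))
  ... | yes (x , 2≤) with b₁ , b₂ , b₁≢b₂ , xb₁∈A , xb₂∈A ← 2≤count⇒distinct (A x) 2≤
                     with Exchange.hall-after-deletion hall b₁≢b₂
  ...   | inj₁ hall₁ = matching-mono (delete-⊆ {A = A}) (go (delete A x b₁) (smaller (edges-delete A xb₁∈A)) hall₁)
  ...   | inj₂ hall₂ = matching-mono (delete-⊆ {A = A}) (go (delete A x b₂) (smaller (edges-delete A xb₂∈A)) hall₂)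

-- Double counting the entries in the rows of S: d · |S| ≤ d · |N(S)|.
regular⇒hall : (A : BoolMatrix m n) (d : ℕ) .{{_ : NonZero d}} →
  (∀ x → count (A x) ≡ d) → (∀ c → count (λ x → A x c) ≤ d) → HallCondition A
regular⇒hall {m} {n} A d rows≡d columns≤d S = *-cancelʳ-≤ (count S) (count N) d (begin
  count S * d                                 ≡⟨ ∑-𝟙*-const S (λ x _ → rows≡d x) ⟨
  ∑[ x < m ] (𝟙 (S x) * count (A x))          ≡⟨ sum-cong-≗ (λ x → count-∧ˡ (A x) (S x)) ⟨
  ∑[ x < m ] count (λ c → S x ∧ A x c)        ≡⟨ ∑-count-comm (λ x c → S x ∧ A x c) ⟩
  ∑[ c < n ] count (λ x → S x ∧ A x c)        ≤⟨ ∑-mono-≤ column≤ ⟩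
  ∑[ c < n ] (𝟙 (N c) * d)                    ≡⟨ ∑-𝟙*-const N (λ _ _ → refl) ⟩
  count N * d                                 ∎)
  where
  open ≤-Reasoning
  N : Fin n → Bool
  N = neighbourhood A S
  column≤ : ∀ c → count (λ x → S x ∧ A x c) ≤ 𝟙 (N c) * d
  column≤ c with T? (N c)
  ... | yes c∈N = begin
    count (λ x → S x ∧ A x c)    ≤⟨ count-mono {q = λ x → A x c} (λ x → proj₂ ∘ Equivalence.to T-∧) ⟩
    count (λ x → A x c)          ≤⟨ columns≤d c ⟩
    d                            ≡⟨ *-identityˡ d ⟨
    1 * d                        ≡⟨ cong (_* d) (𝟙-≡1 c∈N) ⟨
    𝟙 (N c) * d                  ∎
  ... | no  c∉N = begin
    count (λ x → S x ∧ A x c)    ≡⟨ count-≡0 (λ x → S x ∧ A x c) (λ x → c∉N ∘ uncurry (neighbourhood⁺ {A = A} {S}) ∘ Equivalence.to T-∧) ⟩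
    0                            ≤⟨ z≤n ⟩
    𝟙 (N c) * d                  ∎

-- Symmetric designs

-- The order is suc n, so k*k≡k+λ′*n below is the usual relation k (k − 1) = λ (v − 1).
module SymmetricDesign {n k λ′ : ℕ} (inc : Fin (suc n) → Fin (suc n) → Bool)
  (block-size  : ∀ B → count (λ x → inc x B) ≡ k)
  (replication : ∀ x → count (λ B → inc x B) ≡ k)
  (pair-count  : ∀ x y → x ≢ y → count (λ B → inc x B ∧ inc y B) ≡ λ′) where

  common : Fin (suc n) → Fin (suc n) → ℕ
  common y z = count (λ C → inc y C ∧ inc z C)

  meet : Fin (suc n) → Fin (suc n) → ℕ
  meet B C = count (λ y → inc y B ∧ inc y C)

  common-self : ∀ y → common y y ≡ k
  common-self y = trans (count-cong (λ C → ∧-idem (inc y C))) (replication y)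

  meet-self : ∀ B → meet B B ≡ k
  meet-self B = trans (count-cong (λ y → ∧-idem (inc y B))) (block-size B)

  ∑-common : ∀ (q : Fin (suc n) → Bool) y → T (q y) →
    ∑[ z < suc n ] (𝟙 (q z) * common y z) + λ′ ≡ k + λ′ * count q
  ∑-common q y y∈q = begin
    ∑[ z < suc n ] (𝟙 (q z) * common y z) + λ′
      ≡⟨ cong (_+ λ′) (sum-remove {i = y} (λ z → 𝟙 (q z) * common y z)) ⟩
    𝟙 (q y) * common y y + ∑[ j < n ] (𝟙 (q (punchIn y j)) * common y (punchIn y j)) + λ′
      ≡⟨ cong₂ (λ a b → a + b + λ′) (trans (cong₂ _*_ (𝟙-≡1 y∈q) (common-self y)) (*-identityˡ k))
                                     (∑-𝟙*-const (q ∘ punchIn y) (λ j _ → pair-count y (punchIn y j) (punchInᵢ≢i y j ∘ sym))) ⟩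
    k + count (q ∘ punchIn y) * λ′ + λ′
      ≡⟨ arith k (count (q ∘ punchIn y)) λ′ ⟩
    k + λ′ * (1 + count (q ∘ punchIn y))
      ≡⟨ cong (λ c → k + λ′ * (c + count (q ∘ punchIn y))) (𝟙-≡1 y∈q) ⟨
    k + λ′ * (𝟙 (q y) + count (q ∘ punchIn y))
      ≡⟨ cong (λ c → k + λ′ * c) (count-removeAt q y) ⟨
    k + λ′ * count q
      ∎
    where
    open ≡-Reasoning
    arith : ∀ k c l → k + c * l + l ≡ k + l * (1 + c)
    arith = solve-∀

  k*k≡k+λ′*n : k * k ≡ k + λ′ * n
  k*k≡k+λ′*n = +-cancelʳ-≡ λ′ (k * k) (k + λ′ * n) (begin
    k * k + λ′                                          ≡⟨ cong (_+ λ′) ∑-common-zero ⟨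
    ∑[ z < suc n ] (𝟙 true * common zero z) + λ′        ≡⟨ ∑-common (λ _ → true) zero _ ⟩
    k + λ′ * count {suc n} (λ _ → true)                 ≡⟨ cong (λ c → k + λ′ * c) (count-true (suc n)) ⟩
    k + λ′ * suc n                                      ≡⟨ arith k λ′ n ⟩
    k + λ′ * n + λ′                                     ∎)
    where
    open ≡-Reasoning
    arith : ∀ k l n → k + l * suc n ≡ k + l * n + l
    arith = solve-∀
    ∑-common-zero : ∑[ z < suc n ] (𝟙 true * common zero z) ≡ k * k
    ∑-common-zero = begin
      ∑[ z < suc n ] (𝟙 true * common zero z)   ≡⟨ sum-cong-≗ (λ z → *-identityˡ (common zero z)) ⟩
      ∑[ z < suc n ] common zero z              ≡⟨ ∑-count-∧ (λ C z → inc z C) (inc zero) block-size ⟩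
      count (inc zero) * k                      ≡⟨ cong (_* k) (replication zero) ⟩
      k * k                                     ∎

  first-moment : ∀ B → ∑[ C < suc n ] meet B C ≡ k * k
  first-moment B = trans (∑-count-∧ inc (λ y → inc y B) replication) (cong (_* k) (block-size B))

  second-moment : ∀ B → ∑[ C < suc n ] (meet B C * meet B C) + k * λ′ ≡ k * (k + λ′ * k)
  second-moment B = begin
    ∑[ C < suc n ] (meet B C * meet B C) + k * λ′
      ≡⟨ cong₂ _+_ meet-square (cong (_* λ′) (block-size B)) ⟨
    ∑[ y < suc n ] (ι y * g y) + count (λ y → inc y B) * λ′
      ≡⟨ cong (∑[ y < suc n ] (ι y * g y) +_) (∑-𝟙*-const (λ y → inc y B) (λ _ _ → refl)) ⟨
    ∑[ y < suc n ] (ι y * g y) + ∑[ y < suc n ] (ι y * λ′)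
      ≡⟨ ∑-distrib-+ (λ y → ι y * g y) (λ y → ι y * λ′) ⟨
    ∑[ y < suc n ] (ι y * g y + ι y * λ′)
      ≡⟨ sum-cong-≗ (λ y → *-distribˡ-+ (ι y) (g y) λ′) ⟨
    ∑[ y < suc n ] (ι y * (g y + λ′))
      ≡⟨ ∑-𝟙*-const (λ y → inc y B) (λ y y∈B → ∑-common (λ z → inc z B) y y∈B) ⟩
    count (λ y → inc y B) * (k + λ′ * count (λ y → inc y B))
      ≡⟨ cong (λ c → c * (k + λ′ * c)) (block-size B) ⟩
    k * (k + λ′ * k)
      ∎
    where
    open ≡-Reasoning
    ι : Fin (suc n) → ℕ
    ι y = 𝟙 (inc y B)
    g : Fin (suc n) → ℕ
    g y = ∑[ z < suc n ] (ι z * common y z)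
    meet-square : ∑[ y < suc n ] (ι y * g y) ≡ ∑[ C < suc n ] (meet B C * meet B C)
    meet-square = begin
      ∑[ y < suc n ] (ι y * g y)
        ≡⟨ sum-cong-≗ (λ y → cong (ι y *_) (sum-cong-≗ (λ z → cong (ι z *_) (count-∧-as-∑ (inc y) (inc z))))) ⟩
      ∑[ y < suc n ] (ι y * ∑[ z < suc n ] (ι z * ∑[ C < suc n ] (𝟙 (inc y C) * 𝟙 (inc z C))))
        ≡⟨ ∑-square ι (λ y C → 𝟙 (inc y C)) ⟨
      ∑[ C < suc n ] (∑[ y < suc n ] (ι y * 𝟙 (inc y C)) * ∑[ y < suc n ] (ι y * 𝟙 (inc y C)))
        ≡⟨ sum-cong-≗ (λ C → cong₂ _*_ (count-∧-as-∑ (λ y → inc y B) (λ y → inc y C)) (count-∧-as-∑ (λ y → inc y B) (λ y → inc y C))) ⟨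
      ∑[ C < suc n ] (meet B C * meet B C)
        ∎

  -- The blocks other than B are enumerated as punchIn B j, j : Fin n.
  blocks-meet-in-λ : ∀ B C → B ≢ C → meet B C ≡ λ′
  blocks-meet-in-λ B C B≢C = subst (λ C → meet B C ≡ λ′) (punchIn-punchOut B≢C)
    (moments⇒constant (meet B ∘ punchIn B) λ′ S₁≡nλ′ S₂≡nλ′² (punchOut B≢C))
    where
    open ≡-Reasoning
    S₁ S₂ : ℕ
    S₁ = ∑[ j < n ] meet B (punchIn B j)
    S₂ = ∑[ j < n ] (meet B (punchIn B j) * meet B (punchIn B j))
    S₁≡nλ′ : S₁ ≡ n * λ′
    S₁≡nλ′ = +-cancelˡ-≡ k S₁ (n * λ′) (begin
      k + S₁                        ≡⟨ cong (_+ S₁) (meet-self B) ⟨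
      meet B B + S₁                 ≡⟨ sum-remove {i = B} (meet B) ⟨
      ∑[ C < suc n ] meet B C       ≡⟨ first-moment B ⟩
      k * k                         ≡⟨ k*k≡k+λ′*n ⟩
      k + λ′ * n                    ≡⟨ cong (k +_) (*-comm λ′ n) ⟩
      k + n * λ′                    ∎)
    S₂≡nλ′² : S₂ ≡ n * (λ′ * λ′)
    S₂≡nλ′² = +-cancelʳ-≡ (k * λ′) S₂ (n * (λ′ * λ′)) (+-cancelˡ-≡ (k * k) _ _ (begin
      k * k + (S₂ + k * λ′)                                    ≡⟨ +-assoc (k * k) S₂ (k * λ′) ⟨
      k * k + S₂ + k * λ′                                      ≡⟨ cong (λ c → c * c + S₂ + k * λ′) (meet-self B) ⟨
      meet B B * meet B B + S₂ + k * λ′                        ≡⟨ cong (_+ k * λ′) (sum-remove {i = B} (λ C → meet B C * meet B C)) ⟨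
      ∑[ C < suc n ] (meet B C * meet B C) + k * λ′            ≡⟨ second-moment B ⟩
      k * (k + λ′ * k)                                         ≡⟨ expand k λ′ ⟩
      k * k + λ′ * (k * k)                                     ≡⟨ cong (λ c → k * k + λ′ * c) k*k≡k+λ′*n ⟩
      k * k + λ′ * (k + λ′ * n)                                ≡⟨ regroup k λ′ n ⟩
      k * k + (n * (λ′ * λ′) + k * λ′)                         ∎))
      where
      expand : ∀ k l → k * (k + l * k) ≡ k * k + l * (k * k)
      expand = solve-∀
      regroup : ∀ k l n → k * k + l * (k + l * n) ≡ k * k + (n * (l * l) + k * l)
      regroup = solve-∀

-- From a symmetric design to a liking digraph

module _ {n k λ′ : ℕ} {inc : Fin (suc n) → Fin (suc n) → Bool} (design : IsBIBD (suc n) (suc n) k k λ′ inc) where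

  open IsBIBD design
  open SymmetricDesign inc blockSize replication pairs using (blocks-meet-in-λ)

  non-incidence : BoolMatrix (suc n) (suc n)
  non-incidence x B = not (inc x B)

  non-incidence-matching : Matching non-incidence
  non-incidence-matching = hall⇒matching non-incidence (regular⇒hall non-incidence (suc n ∸ k) ⦃ >-nonZero (m<n⇒0<n∸m incomplete) ⦄
    (λ x → trans (count-not (inc x)) (cong (suc n ∸_) (replication x)))
    (λ B → ≤-reflexive (trans (count-not (λ x → inc x B)) (cong (suc n ∸_) (blockSize B)))))

  liking-digraph : Matching non-incidence →
    Σ (Digraph (suc n)) (λ D → Diregular k D × TwoWayTwoLiking λ′ D)
  liking-digraph (σ , x∉σx , σ-inj) = D , diregular , two-way-liking
    where
    D : Digraph (suc n)
    D = record { adj = λ x y → inc y (σ x) ; noLoop = λ x → Equivalence.to T-not-≡ (x∉σx x) }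
    diregular : Diregular k D
    diregular x = blockSize (σ x) , trans (count-∘-injective (λ B → inc x B) σ-inj) (replication x)
    two-way-liking : TwoWayTwoLiking λ′ D
    two-way-liking x y x≢y = blocks-meet-in-λ (σ x) (σ y) (x≢y ∘ σ-inj)
                           , trans (count-∘-injective (λ B → inc x B ∧ inc y B) σ-inj) (pairs x y x≢y)

-- Only incompleteness (k < n) is needed.
proposition3p3 : (n k λ' : ℕ) → 0 < n → 0 < k → 0 < λ' →
    SBIBD n k λ' → 2 * λ' ≤ n →
    Σ (Digraph n) (λ D → Diregular k D × TwoWayTwoLiking λ' D)
proposition3p3 zero    _ _  ()
proposition3p3 (suc n) k λ' _ _ _ (inc , design) _ = liking-digraph design (non-incidence-matching design)
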